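{- Let $I=((G,\lambda),F,k)$ be an instance of Temporal Transitive Completion, where $G=(V,E)$ and $F$ is a proper orientation of $E$, and let $X$ be a solution for $I$. Then for every $(vu,T_{v,u})\in X((G,\lambda),F)$, the oriented temporal graph $(G,\lambda)+X$ (with orientation $F\cup\{uv:(uv,t)\in X\}$) contains an oriented time-edge $(vu,t)$ with $t\ge T_{v,u}$.
   Context: A temporal graph is $(G,\lambda)$ with $G=(V,E)$ finite simple undirected and $\lambda:E\to\mathbb{N}$; a proper orientation $F$ contains exactly one of $uv$, $vu$ for each $\{u,v\}\in E$, and the arc $uv$ carries label $\lambda(u,v)$. A proper orientation is temporally transitive if whenever $(uv,t_1),(vw,t_2)$ are oriented time-edges with $t_2\ge t_1$ there is an oriented time-edge $(uw,t_3)$ with $t_3\ge t_2$. Temporal Transitive Completion instance $((G,\lambda),F,k)$: a set $X$ of oriented time-edges $(uv,t)$ is a solution if $X'=\{\{u,v\}:(uv,t)\in X\}$ is disjoint from $E$, $|X|=|X'|\le k$, and $F\cup\{uv:(uv,t)\in X\}$ is a temporally transitive orientation of $(G,\lambda)+X:=((V,E\cup X'),\lambda')$, where $\lambda'=\lambda$ on $E$ and $\lambda'(u,v)=t$ if $(uv,t)\in X$ or $(vu,t)\in X$. Let $G'=(V,F)$. A directed path $P$ in $G'$ is tail-heavy if the label of its last arc is largest among all its arcs; $t(P)$ is that last label. $T_{u,v}$ is the maximum of $t(P)$ over tail-heavy directed $(u,v)$-paths of length at least $2$ in $G'$ ($\bot$ if none), and $X((G,\lambda),F)=\{(uv,T_{u,v}):T_{u,v}\neq\bot\}$.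 -}

module Defs where

open import Data.Nat using (ℕ; suc; _≤_)
open import Data.Fin using (Fin; zero; suc; inject₁; fromℕ)
open import Data.List using (List; length)
open import Data.List.Membership.Propositional using (_∈_)
open import Data.List.Relation.Unary.All using (All)
open import Data.List.Relation.Unary.AllPairs using (AllPairs)
open import Data.Product using (Σ; ∃; _×_; _,_)
open import Data.Sum using (_⊎_)
open import Function.Definitions using (Injective)
open import Relation.Nullary using (¬_)
open import Relation.Binary.PropositionalEquality using (_≡_; _≢_)

-- E is the (symmetric, irreflexive) edge relation of the finite simple
-- undirected graph G; lab u v is the label λ({u,v}) (only meaningful
-- when E u v, and then required to be symmetric).
record TemporalGraph (n : ℕ) : Set₁ where
  field
    E       : Fin n → Fin n → Set
    E-irr   : ∀ u → ¬ E u u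
    E-sym   : ∀ {u v} → E u v → E v u
    lab     : Fin n → Fin n → ℕ
    lab-sym : ∀ {u v} → E u v → lab u v ≡ lab v u
open TemporalGraph public

record ProperOrientation {n : ℕ} (G : TemporalGraph n) (F : Fin n → Fin n → Set) : Set where
  field
    F⊆E : ∀ {u v} → F u v → E G u v
    one : ∀ {u v} → E G u v → (F u v × ¬ F v u) ⊎ (F v u × ¬ F u v)
open ProperOrientation public

OTEdge : ℕ → Set
OTEdge n = Fin n × Fin n × ℕ

SameEdge : ∀ {n} → OTEdge n → OTEdge n → Set
SameEdge (u , v , _) (u' , v' , _) = (u ≡ u' × v ≡ v') ⊎ (u ≡ v' × v ≡ u')

-- The oriented time-edges of (G,λ) + X with orientation F ∪ {uv : (uv,t) ∈ X}.
OArc : ∀ {n} → TemporalGraph n → (Fin n → Fin n → Set) → List (OTEdge n)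
     → Fin n → Fin n → ℕ → Set
OArc G F X u v t = (F u v × lab G u v ≡ t) ⊎ ((u , v , t) ∈ X)

TemporallyTransitive : ∀ {n} → (Fin n → Fin n → ℕ → Set) → Set
TemporallyTransitive {n} A =
  ∀ (u v w : Fin n) (t₁ t₂ : ℕ) → A u v t₁ → A v w t₂ → t₁ ≤ t₂ →
  ∃ λ t₃ → A u w t₃ × t₂ ≤ t₃

record IsSolution {n : ℕ} (G : TemporalGraph n) (F : Fin n → Fin n → Set)
                  (k : ℕ) (X : List (OTEdge n)) : Set where
  field
    loopless : All (λ { (u , v , _) → u ≢ v }) X
    disjoint : All (λ { (u , v , _) → ¬ E G u v }) X
    -- |X| = |X'|: distinct entries of X have distinct underlying edges
    distinct : AllPairs (λ a b → ¬ SameEdge a b) X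
    size     : length X ≤ k
    transitive : TemporallyTransitive (OArc G F X)
open IsSolution public

-- A directed path in G' = (V, F) with l + 2 arcs (length ≥ 2), given by its
-- vertex sequence (pairwise distinct vertices).
record LongPath {n : ℕ} (F : Fin n → Fin n → Set) (l : ℕ) (u v : Fin n) : Set where
  field
    vtx   : Fin (suc (suc (suc l))) → Fin n
    inj   : Injective _≡_ _≡_ vtx
    arcs  : ∀ (i : Fin (suc (suc l))) → F (vtx (inject₁ i)) (vtx (suc i))
    start : vtx zero ≡ u
    end   : vtx (fromℕ (suc (suc l))) ≡ v
open LongPath public

arcLab : ∀ {n l} {F : Fin n → Fin n → Set} {u v} → TemporalGraph n → LongPath F l u v
       → Fin (suc (suc l)) → ℕ
arcLab G P i = lab G (vtx P (inject₁ i)) (vtx P (suc i))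

tP : ∀ {n l} {F : Fin n → Fin n → Set} {u v} → TemporalGraph n → LongPath F l u v → ℕ
tP {l = l} G P = arcLab G P (fromℕ (suc l))

TailHeavy : ∀ {n l} {F : Fin n → Fin n → Set} {u v} → TemporalGraph n → LongPath F l u v → Set
TailHeavy G P = ∀ i → arcLab G P i ≤ tP G P

-- T_{u,v} = T (≠ ⊥): T is the maximum of t(P) over tail-heavy directed
-- (u,v)-paths of length ≥ 2 in G', i.e. it is attained and is an upper bound.
-- (vu, T) ∈ X((G,λ),F) is exactly IsT G F v u T.
IsT : ∀ {n} → TemporalGraph n → (Fin n → Fin n → Set) → Fin n → Fin n → ℕ → Set
IsT G F u v T =
  (∃ λ l → Σ (LongPath F l u v) λ P → TailHeavy G P × tP G P ≡ T) ×
  (∀ l (P : LongPath F l u v) → TailHeavy G P → tP G P ≤ T)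

-- Along a tail-heavy path every arc label is at most the last one, so the
-- path can be shortcut from the back: once its suffix has been replaced by a
-- single arc of label t ≥ t(P), the first arc (label ≤ t(P) ≤ t) composes with
-- it by temporal transitivity.  Arcs of F are arcs of (G,λ) + X, so the
-- transitive orientation of (G,λ) + X contains an arc vu of label ≥ t(P) = T.
module Submission where

open import Defs
open import Data.Nat using (ℕ; _≤_; suc; zero)
open import Data.Nat.Properties using (≤-refl; ≤-trans)
open import Data.Fin using (Fin; inject₁; fromℕ) renaming (zero to fz; suc to fs)
open import Data.List using (List)
open import Data.Product using (∃; _×_; _,_)
open import Data.Sum using (inj₁)
open import Relation.Binary.PropositionalEquality using (refl)

TemporallyTransitive⇒tailHeavyShortcut :
  ∀ {n} {A : Fin n → Fin n → ℕ → Set} → TemporallyTransitive A →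
  ∀ m (w : Fin (suc (suc m)) → Fin n) (lb : Fin (suc m) → ℕ) →
  (∀ i → A (w (inject₁ i)) (w (fs i)) (lb i)) →
  (∀ i → lb i ≤ lb (fromℕ m)) →
  ∃ λ t → A (w fz) (w (fromℕ (suc m))) t × lb (fromℕ m) ≤ t
TemporallyTransitive⇒tailHeavyShortcut tr zero w lb arc tail-max = lb fz , arc fz , ≤-refl
TemporallyTransitive⇒tailHeavyShortcut tr (suc m) w lb arc tail-max
  with TemporallyTransitive⇒tailHeavyShortcut tr m (λ i → w (fs i)) (λ i → lb (fs i))
         (λ i → arc (fs i)) (λ i → tail-max (fs i))
... | t , suffix , last≤t
  with tr (w fz) (w (fs fz)) (w (fromℕ (suc (suc m)))) (lb fz) t
         (arc fz) suffix (≤-trans (tail-max fz) last≤t)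
... | t₃ , shortcut , t≤t₃ = t₃ , shortcut , ≤-trans last≤t t≤t₃

lemma4p4 : ∀ {n : ℕ} (G : TemporalGraph n) (F : Fin n → Fin n → Set) (k : ℕ)
    → ProperOrientation G F
    → (X : List (OTEdge n)) → IsSolution G F k X
    → ∀ (v u : Fin n) (T : ℕ) → IsT G F v u T
    → ∃ λ t → OArc G F X v u t × T ≤ t
lemma4p4 G F k _ X sol v u T ((l , P , tail-heavy , refl) , _)
  with TemporallyTransitive⇒tailHeavyShortcut (transitive sol) (suc l) (vtx P) (arcLab G P)
         (λ i → inj₁ (arcs P i , refl)) tail-heavy
... | t , arc , T≤t rewrite start P | end P = t , arc , T≤t
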